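{- Let $u,v\ge0$ be integers and let $G(1,1;t)=\sum_{n\ge0}a_nt^n$, where $a_n$ is the number of $n$-step walks on $\mathbb Z^2$ starting at $(u,v)$, with steps in $\{(1,-1),(-1,1)\}$, staying in $(\mathbb N_0)^2$, with arbitrary endpoint. Then $$G(1,1;t)=\frac{(1+p^2)(1-p^{u+1})(1-p^{v+1})}{(1-p)^2(1+p^{u+v+2})},\qquad p=\frac{1-\sqrt{1-4t^2}}{2t}.$$
   Context: $p$ is the formal power series in $t$ with zero constant term given by $p=\frac{1-\sqrt{1-4t^2}}{2t}$; the identity is one of formal power series in $t$. -}

module Defs where

open import Data.Nat using (ℕ; zero; suc; _∸_)
open import Data.Integer using (ℤ; +_; _+_; _*_; -_; _-_; _≤ᵇ_)
open import Data.Bool using (Bool; true; false; _∧_; if_then_else_)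
open import Data.List using (List; []; _∷_; map; _++_)
open import Relation.Binary.PropositionalEquality using (_≡_)

Step : Set
Step = Bool

dx : Step → ℤ
dx true  = + 1
dx false = - (+ 1)

dy : Step → ℤ
dy true  = - (+ 1)
dy false = + 1

staysIn : ℤ → ℤ → List Step → Bool
staysIn x y []       = true
staysIn x y (s ∷ ss) =
  ((+ 0 ≤ᵇ (x + dx s)) ∧ (+ 0 ≤ᵇ (y + dy s))) ∧ staysIn (x + dx s) (y + dy s) ss

allWalks : ℕ → List (List Step)
allWalks zero    = [] ∷ []
allWalks (suc n) = map (true ∷_) (allWalks n) ++ map (false ∷_) (allWalks n)

countTrue : {A : Set} → (A → Bool) → List A → ℕ
countTrue P []       = 0
countTrue P (a ∷ as) = if P a then suc (countTrue P as) else countTrue P as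

walkCount : ℕ → ℕ → ℕ → ℕ
walkCount u v n = countTrue (staysIn (+ u) (+ v)) (allWalks n)

Series : Set
Series = ℕ → ℤ

_≈ₛ_ : Series → Series → Set
f ≈ₛ g = ∀ n → f n ≡ g n

infix 4 _≈ₛ_

const : ℤ → Series
const c zero    = c
const c (suc _) = + 0

tₛ : Series
tₛ 1 = + 1
tₛ _ = + 0

_+ₛ_ : Series → Series → Series
(f +ₛ g) n = f n + g n

_-ₛ_ : Series → Series → Series
(f -ₛ g) n = f n - g n

sumTo : ℕ → (ℕ → ℤ) → ℤ
sumTo zero    h = h zero
sumTo (suc m) h = sumTo m h + h (suc m)

_*ₛ_ : Series → Series → Series
(f *ₛ g) n = sumTo n (λ k → f k * g (n ∸ k))

infixl 6 _+ₛ_ _-ₛ_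
infixl 7 _*ₛ_

_^ₛ_ : Series → ℕ → Series
f ^ₛ zero  = const (+ 1)
f ^ₛ suc k = f *ₛ (f ^ₛ k)

infixr 8 _^ₛ_

G : ℕ → ℕ → Series
G u v n = + walkCount u v n

-- Each step preserves u + v, so the denominator D(u+v) is constant along the walk recursion
--   G(u,v) = 1 + t (G(u+1,v-1) + G(u-1,v+1))   (a term is absent when an index would be negative).
-- The numerator N(u,v) = (1+p²)(1-p^(u+1))(1-p^(v+1)) satisfies the same recursion with D in place
-- of 1, because p = t(1+p²); at the boundary the missing terms come out as 0 by themselves, since
-- 1 - p⁰ = 0. Hence the defect G·D - N is t times the sum of the neighbouring defects, and all its
-- coefficients vanish by induction on the degree. The equation p = t(1+p²) follows from the
-- hypotheses on s: 4t²(1+p²) = (1 - s²) + (1 - s)² = 2(1 - s) = 4tp.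
module Submission where

open import Defs

module PowerSeries where

  open import Data.Nat as ℕ using (ℕ; zero; suc; _∸_; _≤_; z≤n)
  import Data.Nat.Properties as ℕ
  open import Data.Integer as ℤ using (ℤ; +_; -_; _+_; _*_)
  import Data.Integer.Properties as ℤ
  open import Data.Integer.Solver using (module +-*-Solver)
  open import Data.Maybe using (Maybe; just; nothing)
  open import Function using (_∘_)
  open import Level using (0ℓ)
  open import Algebra.Bundles using (CommutativeRing)
  import Algebra.Construct.Pointwise as Pointwise
  import Algebra.Consequences.Setoid as Consequences
  open import Algebra.Properties.CommutativeSemigroup ℤ.+-commutativeSemigroup using (interchange)
  open import Algebra.Solver.Ring.AlmostCommutativeRing
    using (fromCommutativeRing; _-Raw-AlmostCommutative⟶_)
  import Algebra.Solver.Ring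
  import Relation.Binary.Reasoning.Setoid
  open import Relation.Nullary using (yes; no)
  open import Relation.Binary.PropositionalEquality
    using (_≡_; refl; sym; trans; cong; cong₂; _→-setoid_; module ≡-Reasoning)

  sumTo-cong : ∀ n {h h′ : ℕ → ℤ} → (∀ k → k ≤ n → h k ≡ h′ k) → sumTo n h ≡ sumTo n h′
  sumTo-cong zero    eq = eq 0 z≤n
  sumTo-cong (suc n) eq =
    cong₂ _+_ (sumTo-cong n (λ k k≤n → eq k (ℕ.m≤n⇒m≤1+n k≤n))) (eq (suc n) ℕ.≤-refl)

  sumTo-+ : ∀ n (h h′ : ℕ → ℤ) → sumTo n (λ k → h k + h′ k) ≡ sumTo n h + sumTo n h′
  sumTo-+ zero    h h′ = refl
  sumTo-+ (suc n) h h′ rewrite sumTo-+ n h h′ =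
    interchange (sumTo n h) (sumTo n h′) (h (suc n)) (h′ (suc n))

  sumTo-*ˡ : ∀ n c (h : ℕ → ℤ) → sumTo n (λ k → c * h k) ≡ c * sumTo n h
  sumTo-*ˡ zero    c h = refl
  sumTo-*ˡ (suc n) c h rewrite sumTo-*ˡ n c h = sym (ℤ.*-distribˡ-+ c _ _)

  sumTo-suc : ∀ n (h : ℕ → ℤ) → sumTo (suc n) h ≡ h 0 + sumTo n (h ∘ suc)
  sumTo-suc zero    h = refl
  sumTo-suc (suc n) h rewrite sumTo-suc n h = ℤ.+-assoc (h 0) _ _

  sumTo-reverse : ∀ n (h : ℕ → ℤ) → sumTo n h ≡ sumTo n (λ k → h (n ∸ k))
  sumTo-reverse zero    h = refl
  sumTo-reverse (suc n) h = begin
    sumTo (suc n) h                        ≡⟨ sumTo-suc n h ⟩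
    h 0 + sumTo n (h ∘ suc)                ≡⟨ cong (_+_ (h 0)) (sumTo-reverse n (h ∘ suc)) ⟩
    h 0 + sumTo n (λ k → h (suc (n ∸ k)))  ≡⟨ ℤ.+-comm (h 0) _ ⟩
    sumTo n (λ k → h (suc (n ∸ k))) + h 0  ≡⟨ cong₂ _+_ (sumTo-cong n λ k k≤n → cong h (sym (ℕ.+-∸-assoc 1 k≤n)))
                                                    (cong h (sym (ℕ.n∸n≡0 n))) ⟩
    sumTo (suc n) (λ k → h (suc n ∸ k))    ∎
    where open ≡-Reasoning

  -- Pointwise zero (not const (+ 0)), so that the additive group is literally the lifted one of ℤ.
  0ₛ : Series
  0ₛ = λ _ → + 0

  1ₛ : Series
  1ₛ = const (+ 1)

  negₛ : Series → Series
  negₛ f = -_ ∘ f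

  tailₛ : Series → Series
  tailₛ f = f ∘ suc

  _·ₛ_ : ℤ → Series → Series
  (c ·ₛ f) n = c * f n

  infixr 7 _·ₛ_

  *ₛ-cong : ∀ {f f′ g g′} → f ≈ₛ f′ → g ≈ₛ g′ → f *ₛ g ≈ₛ f′ *ₛ g′
  *ₛ-cong f≈ g≈ n = sumTo-cong n λ k _ → cong₂ _*_ (f≈ k) (g≈ (n ∸ k))

  *ₛ-comm : ∀ f g → f *ₛ g ≈ₛ g *ₛ f
  *ₛ-comm f g n = begin
    sumTo n (λ k → f k * g (n ∸ k))              ≡⟨ sumTo-reverse n _ ⟩
    sumTo n (λ k → f (n ∸ k) * g (n ∸ (n ∸ k)))  ≡⟨ sumTo-cong n (λ k k≤n →
        trans (cong (λ j → f (n ∸ k) * g j) (ℕ.m∸[m∸n]≡n k≤n)) (ℤ.*-comm (f (n ∸ k)) (g k))) ⟩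
    sumTo n (λ k → g k * f (n ∸ k))              ∎
    where open ≡-Reasoning

  *ₛ-distribʳ : ∀ h f g → (f +ₛ g) *ₛ h ≈ₛ f *ₛ h +ₛ g *ₛ h
  *ₛ-distribʳ h f g n =
    trans (sumTo-cong n λ k _ → ℤ.*-distribʳ-+ (h (n ∸ k)) (f k) (g k)) (sumTo-+ n _ _)

  ·ₛ-*ₛ : ∀ c f g → (c ·ₛ f) *ₛ g ≈ₛ c ·ₛ (f *ₛ g)
  ·ₛ-*ₛ c f g n = trans (sumTo-cong n λ k _ → ℤ.*-assoc c (f k) _) (sumTo-*ˡ n c _)

  tail-*ₛ : ∀ f g → tailₛ (f *ₛ g) ≈ₛ f 0 ·ₛ tailₛ g +ₛ tailₛ f *ₛ g
  tail-*ₛ f g n = sumTo-suc n _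

  *ₛ-assoc : ∀ f g h → (f *ₛ g) *ₛ h ≈ₛ f *ₛ (g *ₛ h)
  *ₛ-assoc f g h zero    = ℤ.*-assoc (f 0) (g 0) (h 0)
  *ₛ-assoc f g h (suc n) = begin
    ((f *ₛ g) *ₛ h) (suc n)
      ≡⟨ sumTo-suc n _ ⟩
    f 0 * g 0 * h (suc n) + (tailₛ (f *ₛ g) *ₛ h) n
      ≡⟨ cong (_+_ (f 0 * g 0 * h (suc n))) (*ₛ-cong {g = h} (tail-*ₛ f g) (λ _ → refl) n) ⟩
    f 0 * g 0 * h (suc n) + ((f 0 ·ₛ tailₛ g +ₛ tailₛ f *ₛ g) *ₛ h) n
      ≡⟨ cong (_+_ (f 0 * g 0 * h (suc n))) (*ₛ-distribʳ h (f 0 ·ₛ tailₛ g) (tailₛ f *ₛ g) n) ⟩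
    f 0 * g 0 * h (suc n) + (((f 0 ·ₛ tailₛ g) *ₛ h) n + ((tailₛ f *ₛ g) *ₛ h) n)
      ≡⟨ cong₂ (λ a b → f 0 * g 0 * h (suc n) + (a + b))
               (·ₛ-*ₛ (f 0) (tailₛ g) h n) (*ₛ-assoc (tailₛ f) g h n) ⟩
    f 0 * g 0 * h (suc n) + (f 0 * (tailₛ g *ₛ h) n + (tailₛ f *ₛ (g *ₛ h)) n)
      ≡⟨ solve 5 (λ a b c d e → a :* b :* c :+ (a :* d :+ e) := a :* (b :* c :+ d) :+ e) refl
           (f 0) (g 0) (h (suc n)) ((tailₛ g *ₛ h) n) ((tailₛ f *ₛ (g *ₛ h)) n) ⟩
    f 0 * (g 0 * h (suc n) + (tailₛ g *ₛ h) n) + (tailₛ f *ₛ (g *ₛ h)) n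
      ≡⟨ cong (λ x → f 0 * x + (tailₛ f *ₛ (g *ₛ h)) n) (sym (sumTo-suc n _)) ⟩
    f 0 * (g *ₛ h) (suc n) + (tailₛ f *ₛ (g *ₛ h)) n
      ≡⟨ sym (sumTo-suc n _) ⟩
    (f *ₛ (g *ₛ h)) (suc n) ∎
    where open ≡-Reasoning
          open +-*-Solver

  const-*ₛ : ∀ c f → const c *ₛ f ≈ₛ c ·ₛ f
  const-*ₛ c f zero    = refl
  const-*ₛ c f (suc n) = begin
    (const c *ₛ f) (suc n)
      ≡⟨ sumTo-suc n _ ⟩
    c * f (suc n) + sumTo n (λ k → + 0 * f (n ∸ k))
      ≡⟨ cong (_+_ (c * f (suc n))) (sumTo-*ˡ n (+ 0) (f ∘ (n ∸_))) ⟩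
    c * f (suc n) + + 0
      ≡⟨ ℤ.+-identityʳ _ ⟩
    c * f (suc n) ∎
    where open ≡-Reasoning

  *ₛ-identityˡ : ∀ f → 1ₛ *ₛ f ≈ₛ f
  *ₛ-identityˡ f n = trans (const-*ₛ (+ 1) f n) (ℤ.*-identityˡ (f n))

  seriesRing : CommutativeRing 0ℓ 0ℓ
  seriesRing = record
    { Carrier = Series ; _≈_ = _≈ₛ_ ; _+_ = _+ₛ_ ; _*_ = _*ₛ_ ; -_ = negₛ ; 0# = 0ₛ ; 1# = 1ₛ
    ; isCommutativeRing = record
      { isRing = record
        { +-isAbelianGroup = Pointwise.isAbelianGroup ℕ ℤ.+-0-isAbelianGroup
        ; *-cong = *ₛ-cong
        ; *-assoc = *ₛ-assoc
        ; *-identity = comm∧idˡ⇒id *ₛ-comm {1ₛ} *ₛ-identityˡ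
        ; distrib = comm∧distrʳ⇒distr (λ f≈ g≈ n → cong₂ _+_ (f≈ n) (g≈ n)) *ₛ-comm *ₛ-distribʳ
        }
      ; *-comm = *ₛ-comm
      }
    }
    where open Consequences (ℕ →-setoid ℤ)

  constₛ-homomorphism : ℤ.+-*-rawRing -Raw-AlmostCommutative⟶ fromCommutativeRing seriesRing
  constₛ-homomorphism = record
    { ⟦_⟧    = const
    ; +-homo = λ a b → λ { zero → refl ; (suc n) → refl }
    ; *-homo = λ a b n → trans (const-* a b n) (sym (const-*ₛ a (const b) n))
    ; -‿homo = λ a → λ { zero → refl ; (suc n) → refl }
    ; 0-homo = λ { zero → refl ; (suc n) → refl }
    ; 1-homo = λ _ → refl
    }
    where
    const-* : ∀ a b → const (a * b) ≈ₛ a ·ₛ const b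
    const-* a b zero    = refl
    const-* a b (suc n) = sym (ℤ.*-zeroʳ a)

  const-≟ : ∀ a b → Maybe (const a ≈ₛ const b)
  const-≟ a b with a ℤ.≟ b
  ... | yes refl = just λ _ → refl
  ... | no  _    = nothing

  module ≈ₛ-Reasoning = Relation.Binary.Reasoning.Setoid (CommutativeRing.setoid seriesRing)

  module SeriesSolver =
    Algebra.Solver.Ring ℤ.+-*-rawRing (fromCommutativeRing seriesRing) constₛ-homomorphism const-≟

  open CommutativeRing seriesRing
    using (+-cong; +-congˡ; -‿cong; *-cong; *-congˡ)
    renaming (sym to ≈-sym; trans to ≈-trans)

  ^ₛ-+ : ∀ f m n → f ^ₛ (m ℕ.+ n) ≈ₛ f ^ₛ m *ₛ f ^ₛ n
  ^ₛ-+ f zero    n = ≈-sym (*ₛ-identityˡ (f ^ₛ n))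
  ^ₛ-+ f (suc m) n = ≈-trans (*-congˡ {f} (^ₛ-+ f m n)) (≈-sym (*ₛ-assoc f (f ^ₛ m) (f ^ₛ n)))

  tₛ-*ₛ-suc : ∀ f n → (tₛ *ₛ f) (suc n) ≡ f n
  tₛ-*ₛ-suc f n = begin
    (tₛ *ₛ f) (suc n)        ≡⟨ sumTo-suc n _ ⟩
    + 0 + (tailₛ tₛ *ₛ f) n  ≡⟨ ℤ.+-identityˡ _ ⟩
    (tailₛ tₛ *ₛ f) n        ≡⟨ *ₛ-cong {g = f} tail-tₛ (λ _ → refl) n ⟩
    (1ₛ *ₛ f) n              ≡⟨ *ₛ-identityˡ f n ⟩
    f n                      ∎
    where
    open ≡-Reasoning
    tail-tₛ : tailₛ tₛ ≈ₛ 1ₛ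
    tail-tₛ zero    = refl
    tail-tₛ (suc k) = refl

  tₛ-*ₛ-cancelˡ : ∀ {f g} → tₛ *ₛ f ≈ₛ tₛ *ₛ g → f ≈ₛ g
  tₛ-*ₛ-cancelˡ {f} {g} tf≈tg n = begin
    f n                ≡⟨ sym (tₛ-*ₛ-suc f n) ⟩
    (tₛ *ₛ f) (suc n)  ≡⟨ tf≈tg (suc n) ⟩
    (tₛ *ₛ g) (suc n)  ≡⟨ tₛ-*ₛ-suc g n ⟩
    g n                ∎
    where open ≡-Reasoning

  const-*ₛ-cancelˡ : ∀ c .{{_ : ℤ.NonZero c}} {f g} → const c *ₛ f ≈ₛ const c *ₛ g → f ≈ₛ g
  const-*ₛ-cancelˡ c {f} {g} cf≈cg n =
    ℤ.*-cancelˡ-≡ c (f n) (g n) (trans (sym (const-*ₛ c f n)) (trans (cf≈cg n) (const-*ₛ c g n)))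

  coefficients-vanish : {I : Set} (E F : I → Series) → (∀ i → E i ≈ₛ tₛ *ₛ F i) →
    (∀ n → (∀ i → E i n ≡ + 0) → ∀ i → F i n ≡ + 0) → ∀ n i → E i n ≡ + 0
  coefficients-vanish E F E≈tF F-vanishes zero    i = E≈tF i zero
  coefficients-vanish E F E≈tF F-vanishes (suc n) i = begin
    E i (suc n)          ≡⟨ E≈tF i (suc n) ⟩
    (tₛ *ₛ F i) (suc n)  ≡⟨ tₛ-*ₛ-suc (F i) n ⟩
    F i n                ≡⟨ F-vanishes n (coefficients-vanish E F E≈tF F-vanishes n) i ⟩
    + 0                  ∎
    where open ≡-Reasoning

  t*[1+p²]≈p : ∀ {s p} →
    s *ₛ s ≈ₛ const (+ 1) -ₛ const (+ 4) *ₛ tₛ ^ₛ 2 →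
    const (+ 2) *ₛ tₛ *ₛ p ≈ₛ const (+ 1) -ₛ s →
    tₛ *ₛ (1ₛ +ₛ p ^ₛ 2) ≈ₛ p
  t*[1+p²]≈p {s} {p} s² 2tp = tₛ-*ₛ-cancelˡ (const-*ₛ-cancelˡ (+ 4) (begin
    const (+ 4) *ₛ (tₛ *ₛ (tₛ *ₛ (1ₛ +ₛ p ^ₛ 2)))
      ≈⟨ solve 2 (λ t p → con (+ 4) :* (t :* (t :* (con (+ 1) :+ p :^ 2)))
                          := (con (+ 1) :- (con (+ 1) :- con (+ 4) :* t :^ 2))
                             :+ (con (+ 2) :* t :* p) :* (con (+ 2) :* t :* p))
               (λ _ → refl) tₛ p ⟩
    (1ₛ -ₛ (1ₛ -ₛ const (+ 4) *ₛ tₛ ^ₛ 2)) +ₛ (const (+ 2) *ₛ tₛ *ₛ p) *ₛ (const (+ 2) *ₛ tₛ *ₛ p)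
      ≈⟨ +-cong (+-congˡ {1ₛ} (-‿cong (≈-sym s²))) (*-cong 2tp 2tp) ⟩
    (1ₛ -ₛ s *ₛ s) +ₛ (1ₛ -ₛ s) *ₛ (1ₛ -ₛ s)
      ≈⟨ solve 1 (λ s → (con (+ 1) :- s :* s) :+ (con (+ 1) :- s) :* (con (+ 1) :- s)
                        := (con (+ 1) :- s) :+ (con (+ 1) :- s))
               (λ _ → refl) s ⟩
    (1ₛ -ₛ s) +ₛ (1ₛ -ₛ s)
      ≈⟨ +-cong 2tp 2tp ⟨
    const (+ 2) *ₛ tₛ *ₛ p +ₛ const (+ 2) *ₛ tₛ *ₛ p
      ≈⟨ solve 2 (λ t p → con (+ 2) :* t :* p :+ con (+ 2) :* t :* p := con (+ 4) :* (t :* p))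
               (λ _ → refl) tₛ p ⟩
    const (+ 4) *ₛ (tₛ *ₛ p) ∎))
    where
    open ≈ₛ-Reasoning
    open SeriesSolver

module WalkCounts where

  open PowerSeries using (0ₛ; 1ₛ; tₛ-*ₛ-suc)
  open import Data.Nat as ℕ using (ℕ; zero; suc)
  import Data.Nat.Properties as ℕ
  open import Data.Integer as ℤ using (+_; _+_)
  import Data.Integer.Properties as ℤ
  open import Data.Bool using (Bool; true; false)
  open import Data.List using ([]; _∷_; map; _++_)
  open import Function using (_∘_)
  open import Relation.Binary.PropositionalEquality using (_≡_; refl; sym; cong; cong₂; module ≡-Reasoning)

  countTrue-++ : ∀ {A : Set} (P : A → Bool) xs ys →
                 countTrue P (xs ++ ys) ≡ countTrue P xs ℕ.+ countTrue P ys
  countTrue-++ P []       ys = refl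
  countTrue-++ P (x ∷ xs) ys with P x
  ... | true  = cong suc (countTrue-++ P xs ys)
  ... | false = countTrue-++ P xs ys

  countTrue-map : ∀ {A B : Set} (P : B → Bool) (f : A → B) xs →
                  countTrue P (map f xs) ≡ countTrue (P ∘ f) xs
  countTrue-map P f []       = refl
  countTrue-map P f (x ∷ xs) with P (f x)
  ... | true  = cong suc (countTrue-map P f xs)
  ... | false = countTrue-map P f xs

  countTrue-false : ∀ {A : Set} (P : A → Bool) → (∀ a → P a ≡ false) → ∀ xs → countTrue P xs ≡ 0
  countTrue-false P P≡false []       = refl
  countTrue-false P P≡false (x ∷ xs) rewrite P≡false x = countTrue-false P P≡false xs

  walkCount-suc : ∀ u v n → walkCount u v (suc n) ≡
    countTrue (staysIn (+ u) (+ v) ∘ (true ∷_)) (allWalks n) ℕ.+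
    countTrue (staysIn (+ u) (+ v) ∘ (false ∷_)) (allWalks n)
  walkCount-suc u v n = begin
    countTrue P (map (true ∷_) W ++ map (false ∷_) W)
      ≡⟨ countTrue-++ P (map (true ∷_) W) (map (false ∷_) W) ⟩
    countTrue P (map (true ∷_) W) ℕ.+ countTrue P (map (false ∷_) W)
      ≡⟨ cong₂ ℕ._+_ (countTrue-map P (true ∷_) W) (countTrue-map P (false ∷_) W) ⟩
    countTrue (P ∘ (true ∷_)) W ℕ.+ countTrue (P ∘ (false ∷_)) W ∎
    where
    open ≡-Reasoning
    P = staysIn (+ u) (+ v)
    W = allWalks n

  G↘ G↖ : ℕ → ℕ → Series
  G↘ u zero    = 0ₛ
  G↘ u (suc v) = G (suc u) v
  G↖ zero    v = 0ₛ
  G↖ (suc u) v = G u (suc v)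

  count-first-step↘ : ∀ u v n → + countTrue (staysIn (+ u) (+ v) ∘ (true ∷_)) (allWalks n) ≡ G↘ u v n
  count-first-step↘ u zero    n = cong +_ (countTrue-false _ (λ _ → refl) (allWalks n))
  count-first-step↘ u (suc v) n rewrite ℕ.+-comm u 1 = refl

  count-first-step↖ : ∀ u v n → + countTrue (staysIn (+ u) (+ v) ∘ (false ∷_)) (allWalks n) ≡ G↖ u v n
  count-first-step↖ zero    v n = cong +_ (countTrue-false _ (λ _ → refl) (allWalks n))
  count-first-step↖ (suc u) v n rewrite ℕ.+-comm v 1 = refl

  G-recurrence : ∀ u v → G u v ≈ₛ 1ₛ +ₛ tₛ *ₛ (G↘ u v +ₛ G↖ u v)
  G-recurrence u v zero    = refl
  G-recurrence u v (suc n) = begin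
    + walkCount u v (suc n)
      ≡⟨ cong +_ (walkCount-suc u v n) ⟩
    + (countTrue (P ∘ (true ∷_)) W ℕ.+ countTrue (P ∘ (false ∷_)) W)
      ≡⟨ ℤ.pos-+ (countTrue (P ∘ (true ∷_)) W) (countTrue (P ∘ (false ∷_)) W) ⟩
    + countTrue (P ∘ (true ∷_)) W + + countTrue (P ∘ (false ∷_)) W
      ≡⟨ cong₂ _+_ (count-first-step↘ u v n) (count-first-step↖ u v n) ⟩
    (G↘ u v +ₛ G↖ u v) n
      ≡⟨ sym (tₛ-*ₛ-suc (G↘ u v +ₛ G↖ u v) n) ⟩
    (tₛ *ₛ (G↘ u v +ₛ G↖ u v)) (suc n)
      ≡⟨ sym (ℤ.+-identityˡ _) ⟩
    (1ₛ +ₛ tₛ *ₛ (G↘ u v +ₛ G↖ u v)) (suc n) ∎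
    where
    open ≡-Reasoning
    P = staysIn (+ u) (+ v)
    W = allWalks n

module ClosedForm (p : Series) where

  open PowerSeries
  open WalkCounts using (G↘; G↖; G-recurrence)
  open import Data.Nat as ℕ using (ℕ; zero; suc)
  import Data.Nat.Properties as ℕ
  open import Data.Integer using (+_; _+_)
  open import Data.Product using (_,_; uncurry)
  open import Algebra.Bundles using (CommutativeRing)
  open import Relation.Binary.PropositionalEquality using (_≡_; refl; cong₂)
  open CommutativeRing seriesRing
    using (+-cong; +-congˡ; -‿cong; *-congˡ; *-congʳ; zeroˡ; -‿inverseʳ)
    renaming (sym to ≈-sym; trans to ≈-trans)
  open ≈ₛ-Reasoning
  open SeriesSolver

  numerator : ℕ → ℕ → Series
  numerator a b = (1ₛ +ₛ p ^ₛ 2) *ₛ (1ₛ -ₛ p ^ₛ a) *ₛ (1ₛ -ₛ p ^ₛ b)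

  denominator : ℕ → Series
  denominator m = (1ₛ -ₛ p) ^ₛ 2 *ₛ (1ₛ +ₛ p ^ₛ (m ℕ.+ 2))

  numerator-zeroˡ : ∀ b → numerator 0 b ≈ₛ 0ₛ
  numerator-zeroˡ b = ≈-trans
    (solve 2 (λ p β → (con (+ 1) :+ p :^ 2) :* (con (+ 1) :- con (+ 1)) :* (con (+ 1) :- β) := con (+ 0))
           (λ _ → refl) p (p ^ₛ b))
    (λ { zero → refl ; (suc n) → refl })

  numerator-zeroʳ : ∀ a → numerator a 0 ≈ₛ 0ₛ
  numerator-zeroʳ a = ≈-trans
    (solve 2 (λ p α → (con (+ 1) :+ p :^ 2) :* (con (+ 1) :- α) :* (con (+ 1) :- con (+ 1)) := con (+ 0))
           (λ _ → refl) p (p ^ₛ a))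
    (λ { zero → refl ; (suc n) → refl })

  module _ (t[1+p²]≈p : tₛ *ₛ (1ₛ +ₛ p ^ₛ 2) ≈ₛ p) where

    numerator-recurrence : ∀ a b →
      numerator (suc a) (suc b) ≈ₛ
      denominator (a ℕ.+ b) +ₛ tₛ *ₛ (numerator (suc (suc a)) b +ₛ numerator a (suc (suc b)))
    numerator-recurrence a b = begin
      numerator (suc a) (suc b)
        ≈⟨ solve 3 (λ p α β →
             (con (+ 1) :+ p :^ 2) :* (con (+ 1) :- p :* α) :* (con (+ 1) :- p :* β)
             := (con (+ 1) :- p) :^ 2 :* (con (+ 1) :+ α :* β :* p :^ 2) :+ p :* K p α β)
           (λ _ → refl) p α β ⟩
      (1ₛ -ₛ p) ^ₛ 2 *ₛ (1ₛ +ₛ α *ₛ β *ₛ p ^ₛ 2) +ₛ p *ₛ ⟦K⟧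
        ≈⟨ +-cong (*-congˡ {(1ₛ -ₛ p) ^ₛ 2} (+-congˡ {1ₛ} p^[a+b+2]))
                  (*-congʳ {⟦K⟧} (≈-sym t[1+p²]≈p)) ⟩
      denominator (a ℕ.+ b) +ₛ tₛ *ₛ (1ₛ +ₛ p ^ₛ 2) *ₛ ⟦K⟧
        ≈⟨ +-congˡ {denominator (a ℕ.+ b)} (solve 4 (λ t p α β →
             t :* (con (+ 1) :+ p :^ 2) :* K p α β
             := t :* ((con (+ 1) :+ p :^ 2) :* (con (+ 1) :- p :* (p :* α)) :* (con (+ 1) :- β)
                      :+ (con (+ 1) :+ p :^ 2) :* (con (+ 1) :- α) :* (con (+ 1) :- p :* (p :* β))))
           (λ _ → refl) tₛ p α β) ⟩
      denominator (a ℕ.+ b) +ₛ tₛ *ₛ (numerator (suc (suc a)) b +ₛ numerator a (suc (suc b))) ∎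
      where
      α = p ^ₛ a
      β = p ^ₛ b
      K : ∀ {n} → Polynomial n → Polynomial n → Polynomial n → Polynomial n
      K p α β = (con (+ 1) :- p :^ 2 :* α) :* (con (+ 1) :- β) :+ (con (+ 1) :- α) :* (con (+ 1) :- p :^ 2 :* β)
      ⟦K⟧ = (1ₛ -ₛ p ^ₛ 2 *ₛ α) *ₛ (1ₛ -ₛ β) +ₛ (1ₛ -ₛ α) *ₛ (1ₛ -ₛ p ^ₛ 2 *ₛ β)
      p^[a+b+2] : α *ₛ β *ₛ p ^ₛ 2 ≈ₛ p ^ₛ (a ℕ.+ b ℕ.+ 2)
      p^[a+b+2] = ≈-sym (≈-trans (^ₛ-+ p (a ℕ.+ b) 2) (*-congʳ {p ^ₛ 2} (^ₛ-+ p a b)))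

    defect : ℕ → ℕ → Series
    defect u v = G u v *ₛ denominator (u ℕ.+ v) -ₛ numerator (suc u) (suc v)

    defect↘ defect↖ : ℕ → ℕ → Series
    defect↘ u zero    = 0ₛ
    defect↘ u (suc v) = defect (suc u) v
    defect↖ zero    v = 0ₛ
    defect↖ (suc u) v = defect u (suc v)

    defect↘-expand : ∀ u v →
      G↘ u v *ₛ denominator (u ℕ.+ v) -ₛ numerator (suc (suc u)) v ≈ₛ defect↘ u v
    defect↘-expand u zero = begin
      0ₛ *ₛ denominator (u ℕ.+ 0) -ₛ numerator (suc (suc u)) 0
        ≈⟨ +-cong (zeroˡ (denominator (u ℕ.+ 0))) (-‿cong (numerator-zeroʳ (suc (suc u)))) ⟩
      0ₛ -ₛ 0ₛ
        ≈⟨ -‿inverseʳ 0ₛ ⟩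
      0ₛ ∎
    defect↘-expand u (suc v) rewrite ℕ.+-suc u v = λ _ → refl

    defect↖-expand : ∀ u v →
      G↖ u v *ₛ denominator (u ℕ.+ v) -ₛ numerator u (suc (suc v)) ≈ₛ defect↖ u v
    defect↖-expand zero v = begin
      0ₛ *ₛ denominator v -ₛ numerator 0 (suc (suc v))
        ≈⟨ +-cong (zeroˡ (denominator v)) (-‿cong (numerator-zeroˡ (suc (suc v)))) ⟩
      0ₛ -ₛ 0ₛ
        ≈⟨ -‿inverseʳ 0ₛ ⟩
      0ₛ ∎
    defect↖-expand (suc u) v rewrite ℕ.+-suc u v = λ _ → refl

    defect-recurrence : ∀ u v → defect u v ≈ₛ tₛ *ₛ (defect↘ u v +ₛ defect↖ u v)
    defect-recurrence u v = begin
      G u v *ₛ D -ₛ numerator (suc u) (suc v)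
        ≈⟨ +-cong (*-congʳ {D} (G-recurrence u v)) (-‿cong (numerator-recurrence u v)) ⟩
      (1ₛ +ₛ tₛ *ₛ (G↘ u v +ₛ G↖ u v)) *ₛ D -ₛ (D +ₛ tₛ *ₛ (N↘ +ₛ N↖))
        ≈⟨ solve 6 (λ t g↘ g↖ d n↘ n↖ →
             (con (+ 1) :+ t :* (g↘ :+ g↖)) :* d :- (d :+ t :* (n↘ :+ n↖))
             := t :* ((g↘ :* d :- n↘) :+ (g↖ :* d :- n↖)))
           (λ _ → refl) tₛ (G↘ u v) (G↖ u v) D N↘ N↖ ⟩
      tₛ *ₛ ((G↘ u v *ₛ D -ₛ N↘) +ₛ (G↖ u v *ₛ D -ₛ N↖))
        ≈⟨ *-congˡ {tₛ} (+-cong (defect↘-expand u v) (defect↖-expand u v)) ⟩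
      tₛ *ₛ (defect↘ u v +ₛ defect↖ u v) ∎
      where
      D  = denominator (u ℕ.+ v)
      N↘ = numerator (suc (suc u)) v
      N↖ = numerator u (suc (suc v))

    defect≈0 : ∀ u v → defect u v ≈ₛ 0ₛ
    defect≈0 u v n =
      coefficients-vanish (uncurry defect) (uncurry λ u v → defect↘ u v +ₛ defect↖ u v)
        (uncurry defect-recurrence) neighbours-vanish n (u , v)
      where
      neighbours-vanish : ∀ n → (∀ i → uncurry defect i n ≡ + 0) →
                          ∀ i → uncurry (λ u v → defect↘ u v +ₛ defect↖ u v) i n ≡ + 0
      neighbours-vanish n defect≡0 (u , v) = cong₂ _+_ (↘≡0 u v) (↖≡0 u v)
        where
        ↘≡0 : ∀ u v → defect↘ u v n ≡ + 0
        ↘≡0 u zero    = refl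
        ↘≡0 u (suc v) = defect≡0 (suc u , v)
        ↖≡0 : ∀ u v → defect↖ u v n ≡ + 0
        ↖≡0 zero    v = refl
        ↖≡0 (suc u) v = defect≡0 (u , suc v)

open import Data.Nat using (ℕ; _+_)
open import Data.Integer using (ℤ; +_)
open import Relation.Binary.PropositionalEquality using (_≡_)
import Data.Nat.Properties as ℕ
import Data.Integer.Properties as ℤ
open PowerSeries using (t*[1+p²]≈p)
open ClosedForm using (defect≈0)

corollary2 : (u v : ℕ) (s p : Series) →
    s 0 ≡ + 1 →
    s *ₛ s ≈ₛ const (+ 1) -ₛ const (+ 4) *ₛ tₛ ^ₛ 2 →
    const (+ 2) *ₛ tₛ *ₛ p ≈ₛ const (+ 1) -ₛ s →
    G u v *ₛ ((const (+ 1) -ₛ p) ^ₛ 2 *ₛ (const (+ 1) +ₛ p ^ₛ (u + v + 2)))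
      ≈ₛ (const (+ 1) +ₛ p ^ₛ 2) *ₛ (const (+ 1) -ₛ p ^ₛ (u + 1)) *ₛ (const (+ 1) -ₛ p ^ₛ (v + 1))
corollary2 u v s p _ s² 2tp rewrite ℕ.+-comm u 1 | ℕ.+-comm v 1 = λ n →
  ℤ.i-j≡0⇒i≡j _ _ (defect≈0 p (t*[1+p²]≈p s² 2tp) u v n)
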